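{- Let $(P_z)_{z\in C(I)}$ be a $k$-pseudoflower on index set $I$. For every $x\in\bigcup_{v\in C(I)\setminus I}P_v$, the set $\{w\in C(I): x\in P_w\}$ is an interval of $C(I)$.
   Context: Universe: $V$ is a set and $\mathcal{U}$ is a set of pairs $(A,B)$ with $A\cup B=V$ (called separations), closed under $(A,B)\wedge(C,D)=(A\cap C,B\cup D)$, $(A,B)\vee(C,D)=(A\cup C,B\cap D)$ and $(A,B)^*=(B,A)$. The order of $(A,B)$ is $|A\cap B|$ (or $\infty$). $k\in\mathbb{N}$. Cyclic orders: a cyclic order on $S$ is a set $Z\subseteq S^3$ with: $(a,b,c)\in Z\Rightarrow(b,c,a)\in Z$; $(a,b,c)\in Z\Rightarrow(c,b,a)\notin Z$; for pairwise distinct $a,b,c$, $(a,b,c)\notin Z\Rightarrow (c,b,a)\in Z$; $(a,b,c),(a,c,d)\in Z\Rightarrow(a,b,d)\in Z$. Write $]a,b[=\{c:(a,c,b)\in Z\}$, $[a,b]=]a,b[\cup\{a,b\}$. A subset $J$ is an interval if for all $s,t\in J$, $[s,t]\subseteq J$ or $[t,s]\subseteq J$; non-trivial if neither empty nor everything. For a cyclically ordered set $I$ with $|I|\ge2$, its cycle completion $C(I)$ is a cyclically ordered set containing $I$ (inducing the given order on $I$) such that every non-trivial interval of $I$ can be written uniquely as $[v,w]\cap I$ with $v,w\in C(I)\setminus I$. Every $i\in I$ has a predecessor $p(i)$ and successor $s(i)$ in $C(I)$. $k$-pseudoflowers: for $I$ cyclically ordered with $|I|\ge2$ and a family $(P_z)_{z\in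 C(I)}$ of subsets of $V$, put $X=V\setminus\bigcup_z P_z$, $V(v,w)=X\cup\bigcup_{z\in[v,w]}P_z$ for $v,w\in C(I)\setminus I$, and $S(v,w)=(V(v,w),V(w,v))$ for $v\neq w$. The family is a $k$-pseudoflower on index set $I$ if (i) $|P_v|=(k-|X|)/2$ for all $v\in C(I)\setminus I$; (ii) for distinct $v,w\in C(I)\setminus I$, $S(v,w)\in\mathcal{U}$ has order at most $k$ and $V(v,w)\cap V(w,v)=P_v\cup P_w\cup X$; (iii) $P_{p(i)}\cup P_{s(i)}\subseteq P_i$ for all $i\in I$; (iv) for $i,i'\in I$, if $|P_i|=(k-|X|)/2$ and $P_i=P_{i'}$ then $i=i'$. -}

module Defs where

open import Level using (0ℓ)
open import Data.Nat using (ℕ; _≤_; _+_; _*_)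
open import Data.Product using (Σ; _×_; _,_)
open import Data.Sum using (_⊎_)
open import Relation.Nullary using (¬_)
open import Relation.Unary using (_⊆_; _∩_; _∪_)
open import Relation.Binary.PropositionalEquality using (_≡_; _≢_)
open import Data.List using (List; length)
open import Data.List.Relation.Unary.Unique.Propositional using (Unique)
import Data.List.Membership.Propositional as L

Subset : Set → Set₁
Subset V = V → Set

_≐_ : {V : Set} → Subset V → Subset V → Set
_≐_ {V} A B = ∀ (x : V) → (A x → B x) × (B x → A x)

infix 4 _≐_

HasSize : {V : Set} → Subset V → ℕ → Set
HasSize {V} A n =
  Σ (List V) λ xs → Unique xs × length xs ≡ n
    × (∀ (x : V) → (A x → x L.∈ xs) × (x L.∈ xs → A x))

Sep : Set → Set₁
Sep V = Subset V × Subset V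

-- order of (A , B) is |A ∩ B|; "order at most k" means A ∩ B is finite
-- of size ≤ k
OrderAtMost : {V : Set} → Sep V → ℕ → Set
OrderAtMost (A , B) k = Σ ℕ λ n → n ≤ k × HasSize (A ∩ B) n

-- a universe 𝒰 of separations: a set (extensional predicate) of pairs
-- (A , B) with A ∪ B = V, closed under ∧, ∨ and *.
record Universe (V : Set) : Set₁ where
  field
    U      : Sep V → Set
    U-resp : ∀ {A B C D : Subset V} → A ≐ C → B ≐ D → U (A , B) → U (C , D)
    U-cover : ∀ {A B : Subset V} → U (A , B) → ∀ (x : V) → A x ⊎ B x
    U-meet : ∀ {A B C D : Subset V} → U (A , B) → U (C , D) → U (A ∩ C , B ∪ D)
    U-join : ∀ {A B C D : Subset V} → U (A , B) → U (C , D) → U (A ∪ C , B ∩ D)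
    U-star : ∀ {A B : Subset V} → U (A , B) → U (B , A)

record IsCyclicOrder {S : Set} (Z : S → S → S → Set) : Set where
  field
    cyclic : ∀ {a b c} → Z a b c → Z b c a
    asym   : ∀ {a b c} → Z a b c → ¬ Z c b a
    total  : ∀ {a b c} → a ≢ b → b ≢ c → a ≢ c → ¬ Z a b c → Z c b a
    trans  : ∀ {a b c d} → Z a b c → Z a c d → Z a b d

module CyclicNotions {S : Set} (Z : S → S → S → Set) where

  open-iv : S → S → Subset S
  open-iv a b c = Z a c b

  closed-iv : S → S → Subset S
  closed-iv a b c = (c ≡ a ⊎ c ≡ b) ⊎ Z a c b

  IsInterval : Subset S → Set
  IsInterval J = ∀ s t → J s → J t →
    (closed-iv s t ⊆ J) ⊎ (closed-iv t s ⊆ J)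

  -- J is an interval of the subset I ⊆ S with the induced cyclic order
  -- (intervals of I are computed as [s,t] ∩ I)
  IsIntervalOf : Subset S → Subset S → Set
  IsIntervalOf I J = (J ⊆ I) × (∀ s t → J s → J t →
    ((closed-iv s t ∩ I) ⊆ J) ⊎ ((closed-iv t s ∩ I) ⊆ J))

  NonTrivialIn : Subset S → Subset S → Set
  NonTrivialIn I J = (Σ S λ s → J s) × (Σ S λ s → I s × ¬ J s)

  IsSucc : S → S → Set
  IsSucc i z = (z ≢ i) × (∀ c → ¬ Z i c z)

  IsPred : S → S → Set
  IsPred i z = (z ≢ i) × (∀ c → ¬ Z z c i)

  Represents : Subset S → Subset S → S → S → Set
  Represents I J v w = ∀ i → I i → (J i → closed-iv v w i) × (closed-iv v w i → J i)

  -- (S , Z) together with the subset I is a cycle completion C(I) of I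
  -- (I carrying the induced cyclic order, |I| ≥ 2).
  record IsCycleCompletion (I : Subset S) : Set₁ where
    field
      isCyclicOrder : IsCyclicOrder Z
      atLeastTwo    : Σ S λ a → Σ S λ b → I a × I b × a ≢ b
      represent     : ∀ (J : Subset S) → IsIntervalOf I J → NonTrivialIn I J →
        Σ S λ v → Σ S λ w → ¬ I v × ¬ I w × Represents I J v w
          × (∀ v' w' → ¬ I v' → ¬ I w' → Represents I J v' w' → (v' ≡ v) × (w' ≡ w))

module PseudoflowerNotions {V : Set} (𝒰 : Universe V) (k : ℕ)
  {C : Set} (Z : C → C → C → Set) (I : Subset C) (P : C → Subset V) where

  open Universe 𝒰
  open CyclicNotions Z

  X : Subset V
  X x = ¬ (Σ C λ z → P z x)

  Vof : C → C → Subset V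
  Vof v w x = X x ⊎ (Σ C λ z → closed-iv v w z × P z x)

  Sof : C → C → Sep V
  Sof v w = (Vof v w , Vof w v)

  -- |P| = (k - |X|)/2, read as 2|P| + |X| = k with X finite of size xs
  HalfSize : ℕ → Subset V → Set
  HalfSize xs A = Σ ℕ λ n → HasSize A n × (2 * n + xs ≡ k)

  record IsPseudoflower : Set₁ where
    field
      xSize  : ℕ
      X-size : HasSize X xSize
      cond-i   : ∀ v → ¬ I v → HalfSize xSize (P v)
      cond-ii  : ∀ v w → ¬ I v → ¬ I w → v ≢ w →
        U (Sof v w) × OrderAtMost (Sof v w) k
          × ((Vof v w ∩ Vof w v) ≐ (P v ∪ P w ∪ X))
      cond-iii : ∀ i → I i → ∀ z → IsPred i z ⊎ IsSucc i z → P z ⊆ P i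
      cond-iv  : ∀ i i' → I i → I i' → HalfSize xSize (P i) → P i ≐ P i' → i ≡ i'

module Submission where

-- Suppose x ∈ P s ∩ P t but both open arcs ]s,t[ and ]t,s[ contain an index
-- whose part misses x. Such an index can be taken outside I: an index a ∈ I
-- is replaced by its predecessor p(a) ∉ I, which stays in the arc and misses
-- x because P_{p(a)} ⊆ P_a. For the resulting u ∈ ]s,t[ and u' ∈ ]t,s[ the
-- separation S(u,u') has x on both sides (via P t and P s), so by (ii) x lies
-- in P u ∪ P u' ∪ X, which is impossible.

open import Defs
open import Level using (0ℓ)
open import Axiom.ExcludedMiddle using (ExcludedMiddle)
open import Data.Nat using (ℕ)
open import Data.Product using (Σ; _×_; _,_; proj₁; proj₂)
open import Data.Sum using (inj₁; inj₂)
open import Data.Empty using (⊥; ⊥-elim)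
open import Relation.Unary using (_⊆_; ｛_｝)
open import Relation.Nullary using (¬_; yes; no)
open import Relation.Binary.PropositionalEquality using (_≡_; _≢_; refl; sym)

module CyclicOrderProperties
  (em : ExcludedMiddle 0ℓ) {S : Set} {Z : S → S → S → Set} (co : IsCyclicOrder Z) where

  open IsCyclicOrder co
  open CyclicNotions Z

  Z⇒≢₁₂ : ∀ {a b c} → Z a b c → a ≢ b
  Z⇒≢₁₂ z refl = asym (cyclic z) (cyclic z)

  Z⇒≢₂₃ : ∀ {a b c} → Z a b c → b ≢ c
  Z⇒≢₂₃ z refl = asym z (cyclic z)

  trans-tail : ∀ {a b c d} → Z a b c → Z a c d → Z b c d
  trans-tail {b = b} {c} {d} zabc zacd with em {Z b c d}
  ... | yes zbcd = zbcd
  ... | no ¬zbcd = ⊥-elim (asym zabc (trans (cyclic zdcb) (cyclic zacd)))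
    where
    b≢d : b ≢ d
    b≢d refl = asym zabc (cyclic zacd)

    zdcb : Z d c b
    zdcb = total (Z⇒≢₂₃ zabc) (Z⇒≢₂₃ zacd) b≢d ¬zbcd

  opposite-arcs : ∀ {s t u u'} → Z s u t → Z t u' s → Z u t u'
  opposite-arcs zsut ztu's = cyclic (cyclic (trans ztu's (cyclic (cyclic zsut))))

  pred-∈-arc : ∀ {s t a v} → IsPred a v → v ≢ s → Z s a t → Z s v t
  pred-∈-arc {s} {a = a} {v} (v≢a , nothing-between) v≢s zsat with em {Z v s a}
  ... | yes zvsa = ⊥-elim (nothing-between s zvsa)
  ... | no ¬zvsa = trans (cyclic (total v≢s (Z⇒≢₁₂ zsat) v≢a ¬zvsa)) zsat

  gap : ∀ {J : Subset S} {s t} → J s → J t → ¬ (closed-iv s t ⊆ J) →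
    Σ S λ a → Z s a t × ¬ J a
  gap {J} {s} {t} js jt ¬[s,t]⊆J with em {Σ S λ a → Z s a t × ¬ J a}
  ... | yes found = found
  ... | no none = ⊥-elim (¬[s,t]⊆J [s,t]⊆J)
    where
    [s,t]⊆J : closed-iv s t ⊆ J
    [s,t]⊆J (inj₁ (inj₁ refl)) = js
    [s,t]⊆J (inj₁ (inj₂ refl)) = jt
    [s,t]⊆J {c} (inj₂ zsct) with em {J c}
    ... | yes jc = jc
    ... | no ¬jc = ⊥-elim (none (c , zsct , ¬jc))

  isInterval-if-no-two-gaps : ∀ {J : Subset S} →
    (∀ {s t a b} → J s → J t → Z s a t → ¬ J a → Z t b s → ¬ J b → ⊥) →
    IsInterval J
  isInterval-if-no-two-gaps {J} no-two-gaps s t js jt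
    with em {closed-iv s t ⊆ J} | em {closed-iv t s ⊆ J}
  ... | yes [s,t]⊆J | _ = inj₁ [s,t]⊆J
  ... | no _ | yes [t,s]⊆J = inj₂ [t,s]⊆J
  ... | no ¬[s,t]⊆J | no ¬[t,s]⊆J
    with gap js jt ¬[s,t]⊆J | gap jt js ¬[t,s]⊆J
  ... | a , zsat , ¬ja | b , ztbs , ¬jb = ⊥-elim (no-two-gaps js jt zsat ¬ja ztbs ¬jb)

module CycleCompletionProperties
  (em : ExcludedMiddle 0ℓ) {S : Set} {Z : S → S → S → Set} {I : Subset S}
  (cc : CyclicNotions.IsCycleCompletion Z I) where

  open CyclicNotions Z
  open IsCycleCompletion cc
  open IsCyclicOrder isCyclicOrder
  open CyclicOrderProperties em isCyclicOrder

  singleton-isIntervalOf : ∀ {a} → I a → IsIntervalOf I ｛ a ｝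
  singleton-isIntervalOf ia = (λ { refl → ia }) , λ { _ _ refl refl → inj₁ ⊆｛a｝ }
    where
    ⊆｛a｝ : ∀ {a c} → closed-iv a a c × I c → a ≡ c
    ⊆｛a｝ (inj₁ (inj₁ refl) , _) = refl
    ⊆｛a｝ (inj₁ (inj₂ refl) , _) = refl
    ⊆｛a｝ (inj₂ z , _)           = ⊥-elim (asym z z)

  singleton-nonTrivial : ∀ {a} → I a → NonTrivialIn I ｛ a ｝
  singleton-nonTrivial {a} ia = (a , refl) , other
    where
    other : Σ S λ b → I b × a ≢ b
    other with atLeastTwo
    ... | p , q , ip , iq , p≢q with em {a ≡ p}
    ...   | yes refl = q , iq , p≢q
    ...   | no a≢p = p , ip , a≢p

  -- p(a) is the left endpoint of the representation [v,w] ∩ I of {a}; a point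
  -- c ∉ I strictly between v and a would represent {a} as well.
  predecessor : ∀ {a} → I a → Σ S λ v → ¬ I v × IsPred a v
  predecessor {a} ia
    with represent ｛ a ｝ (singleton-isIntervalOf ia) (singleton-nonTrivial ia)
  ... | v , w , ¬iv , ¬iw , rep , unique = v , ¬iv , v≢a , nothing-between
    where
    v≢a : v ≢ a
    v≢a refl = ¬iv ia

    zvaw : Z v a w
    zvaw with proj₁ (rep a ia) refl
    ... | inj₁ (inj₁ refl) = ⊥-elim (¬iv ia)
    ... | inj₁ (inj₂ refl) = ⊥-elim (¬iw ia)
    ... | inj₂ z = z

    nothing-between : ∀ c → ¬ Z v c a
    nothing-between c zvca with em {I c}
    ... | yes ic with proj₂ (rep c ic) (inj₂ (trans zvca zvaw))
    ...   | refl = asym zvca (cyclic zvca)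
    nothing-between c zvca | no ¬ic = Z⇒≢₁₂ zvca (sym (proj₁ (unique c w ¬ic ¬iw rep-c)))
      where
      rep-c : Represents I ｛ a ｝ c w
      rep-c i ii = (λ { refl → inj₂ (trans-tail zvca zvaw) }) , back
        where
        back : closed-iv c w i → a ≡ i
        back (inj₁ (inj₁ refl)) = ⊥-elim (¬ic ii)
        back (inj₁ (inj₂ refl)) = ⊥-elim (¬iw ii)
        back (inj₂ zciw) =
          proj₂ (rep i ii) (inj₂ (cyclic (cyclic (trans-tail zciw (cyclic (trans zvca zvaw))))))

module PseudoflowerProperties
  (em : ExcludedMiddle 0ℓ) {V : Set} (𝒰 : Universe V) (k : ℕ)
  {C : Set} (Z : C → C → C → Set) (I : Subset C) (P : C → Subset V)
  (cc : CyclicNotions.IsCycleCompletion Z I)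
  (pf : PseudoflowerNotions.IsPseudoflower 𝒰 k Z I P) where

  open CyclicNotions Z
  open IsCycleCompletion cc
  open IsCyclicOrder isCyclicOrder
  open CyclicOrderProperties em isCyclicOrder
  open CycleCompletionProperties em cc
  open PseudoflowerNotions 𝒰 k Z I P
  open IsPseudoflower pf

  gap-outside-I : ∀ {x s t a} → P s x → Z s a t → ¬ P a x →
    Σ C λ u → ¬ I u × Z s u t × ¬ P u x
  gap-outside-I {x} {s} {a = a} ps zsat ¬pa with em {I a}
  ... | no ¬ia = a , ¬ia , zsat , ¬pa
  ... | yes ia with predecessor ia
  ...   | v , ¬iv , v-pred = v , ¬iv , pred-∈-arc v-pred v≢s zsat , ¬pv
    where
    ¬pv : ¬ P v x
    ¬pv pv = ¬pa (cond-iii a ia v (inj₁ v-pred) pv)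

    v≢s : v ≢ s
    v≢s refl = ¬pv ps

  no-two-gaps : ∀ {x s t a b} → P s x → P t x →
    Z s a t → ¬ P a x → Z t b s → ¬ P b x → ⊥
  no-two-gaps {x} {s} {t} ps pt zsat ¬pa ztbs ¬pb
    with gap-outside-I ps zsat ¬pa | gap-outside-I pt ztbs ¬pb
  ... | u , ¬iu , zsut , ¬pu | u' , ¬iu' , ztu's , ¬pu'
    with cond-ii u u' ¬iu ¬iu' (λ { refl → asym zsut ztu's })
  ... | _ , _ , separator-eq
    with proj₁ (separator-eq x) (inj₂ (t , inj₂ (opposite-arcs zsut ztu's) , pt)
                                , inj₂ (s , inj₂ (opposite-arcs ztu's zsut) , ps))
  ... | inj₁ pu = ¬pu pu
  ... | inj₂ (inj₁ pu') = ¬pu' pu'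
  ... | inj₂ (inj₂ x∈X) = x∈X (s , ps)

lemma3p6 : ExcludedMiddle 0ℓ →
    {V : Set} (𝒰 : Universe V) (k : ℕ)
    {C : Set} (Z : C → C → C → Set) (I : Subset C) (P : C → Subset V) →
    CyclicNotions.IsCycleCompletion Z I →
    PseudoflowerNotions.IsPseudoflower 𝒰 k Z I P →
    ∀ (x : V) → (Σ C λ v → ¬ I v × P v x) →
    CyclicNotions.IsInterval Z (λ w → P w x)
lemma3p6 em 𝒰 k Z I P cc pf x _ =
  isInterval-if-no-two-gaps (PseudoflowerProperties.no-two-gaps em 𝒰 k Z I P cc pf)
  where
  open CyclicOrderProperties em (CyclicNotions.IsCycleCompletion.isCyclicOrder cc)
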